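{- For every integer $k\ge0$ there is a graph $G_k$ with tree-width at most $k$ and track-number $\mathrm{tn}(G_k)=\tfrac12(k+1)(k+2)$.
   Context: A colouring of $G$ is a partition $\{V_i:i\in I\}$ of $V(G)$ with no edge inside a class; a track assignment is a colouring with a total order $<_i$ on each $V_i$; an X-crossing is a pair of edges $vw$, $xy$ with $v,x\in V_i$, $w,y\in V_j$, $i\ne j$, $v<_i x$, $y<_j w$; a $t$-track layout is a track assignment with $t$ tracks and no X-crossing; the track-number $\mathrm{tn}(G)$ is the minimum such $t$. -}

module Defs where

open import Data.Nat using (ℕ; zero; suc; _+_; _*_; _≤_; _<_)
open import Data.Fin using (Fin; toℕ) renaming (suc to fsuc; zero to fzero)
open import Data.Fin.Subset using (Subset; _∈_; ∣_∣)
open import Data.Bool using (Bool; true; false)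
open import Data.Product using (Σ; ∃; _×_; _,_)
open import Data.Sum using (_⊎_)
open import Data.Empty using (⊥)
open import Relation.Binary.PropositionalEquality using (_≡_; _≢_)

record Graph : Set where
  field
    n     : ℕ
    adj   : Fin n → Fin n → Bool
    sym   : ∀ u v → adj u v ≡ adj v u
    irr   : ∀ v → adj v v ≡ false

open Graph public

Edge : (G : Graph) → Fin (n G) → Fin (n G) → Set
Edge G u v = adj G u v ≡ true

-- A track assignment with t tracks: a colouring τ : V → Fin t (class V_i =
-- τ⁻¹(i)) together with a total order on each class, encoded by a position
-- function that is injective on each class (u <_i v  iff  pos u < pos v).
record TrackAssignment (G : Graph) (t : ℕ) : Set where
  field
    track    : Fin (n G) → Fin t
    pos      : Fin (n G) → ℕ
    proper   : ∀ u v → Edge G u v → track u ≢ track v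
    posInj   : ∀ u v → track u ≡ track v → pos u ≡ pos v → u ≡ v

open TrackAssignment public

XCrossing : {G : Graph} {t : ℕ} → TrackAssignment G t → Set
XCrossing {G} A =
  Σ (Fin (n G)) λ v → Σ (Fin (n G)) λ w → Σ (Fin (n G)) λ x → Σ (Fin (n G)) λ y →
    Edge G v w × Edge G x y ×
    track A v ≡ track A x × track A w ≡ track A y × track A v ≢ track A w ×
    pos A v < pos A x × pos A y < pos A w

record TrackLayout (G : Graph) (t : ℕ) : Set where
  field
    assignment : TrackAssignment G t
    noX        : XCrossing assignment → ⊥

TrackNumberIs : Graph → ℕ → Set
TrackNumberIs G N = TrackLayout G N × (∀ t → TrackLayout G t → N ≤ t)

-- A finite tree on node set Fin (suc m), given by a parent function:
-- node (fsuc i) is adjacent to its parent (parent i), which has smaller index.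
-- (Every finite tree is isomorphic to one of this form.)
record Tree : Set where
  field
    m        : ℕ
    parent   : Fin m → Fin (suc m)
    parent<  : ∀ i → toℕ (parent i) ≤ toℕ i

open Tree public

Node : Tree → Set
Node T = Fin (suc (m T))

TreeAdj : (T : Tree) → Node T → Node T → Set
TreeAdj T a b = (Σ (Fin (m T)) λ i → a ≡ fsuc i × b ≡ parent T i)
              ⊎ (Σ (Fin (m T)) λ i → b ≡ fsuc i × a ≡ parent T i)

data WalkIn {A : Set} (R : A → A → Set) (P : A → Set) : A → A → Set where
  stay : ∀ {a} → P a → WalkIn R P a a
  step : ∀ {a b c} → P a → R a b → WalkIn R P b c → WalkIn R P a c

record TreeDecomposition (G : Graph) (k : ℕ) : Set where
  field
    tree      : Tree
    bag       : Node tree → Subset (n G)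
    vertexCov : ∀ v → Σ (Node tree) λ x → v ∈ bag x
    edgeCov   : ∀ u v → Edge G u v → Σ (Node tree) λ x → (u ∈ bag x × v ∈ bag x)
    connected : ∀ v x y → v ∈ bag x → v ∈ bag y →
                WalkIn (TreeAdj tree) (λ z → v ∈ bag z) x y
    width     : ∀ x → ∣ bag x ∣ ≤ suc k

TreeWidth≤ : Graph → ℕ → Set
TreeWidth≤ G k = TreeDecomposition G k

-- Fix M. The graph G₀ is a single vertex, and G_{j+1} consists of a clique K_{j+1} together
-- with M disjoint copies of the cone over G_j (an apex joined to a copy of G_j), every apex
-- being adjacent to the whole clique.
--
-- Tree-width: add the apex to every bag of a decomposition of its copy of G_j, hang the result
-- below a bag K_{j+1} ∪ {apex}, and hang these M trees below a root bag K_{j+1}.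
--
-- Upper bound: the clique vertices get private tracks, all apexes share one further track,
-- and the M copies of G_j are laid out one after another on the same triangle j tracks. This
-- uses (j+1) + 1 + triangle j = triangle (j+1) tracks.
--
-- Lower bound: in a layout with t tracks and 2t < M, three apexes lie on a common track. A
-- vertex of the copy of the middle one cannot share a track with a clique vertex v, since
-- otherwise its edge to the middle apex crosses the edge from v to one of the outer apexes.
-- So the clique, the middle apex and its copy of G_j occupy pairwise disjoint sets of tracks,
-- and induction yields triangle (j+1) distinct tracks.

module Submission where

open import Defs hiding (sym; track; pos; proper; posInj)
open import Data.Nat using (ℕ; suc; _*_; _/_)
open import Data.Product using (Σ; _×_)
open import Data.Nat using (zero; _+_; _<_; _≤_; s≤s; z≤n; _≤?_)
open import Data.Nat.Properties
  using (+-suc; ≤-trans; ≤-reflexive; ≤-refl; m≤m+n; n≤1+n; +-monoʳ-≤; m<n⇒m<1+n; <-cmp;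
         <-irrefl; <-asym; ≤-<-trans; +-cancelˡ-<; *-monoʳ-≤; <⇒≤; ≰⇒>; module ≤-Reasoning)
open import Data.Nat.DivMod using (m*n/n≡m)
open import Data.Nat.Solver using (module +-*-Solver)
open import Data.Fin
  using (Fin; toℕ; fromℕ<; punchIn; punchOut; combine; remQuot; join; splitAt)
  renaming (zero to fzero; suc to fsuc)
open import Data.Fin.Properties
  using (_≟_; pigeonhole; any?; <⇒≢; punchIn-injective; punchInᵢ≢i; punchOut-injective;
         punchIn-punchOut; toℕ-injective; toℕ-fromℕ<; toℕ<n; toℕ-combine; combine-monoˡ-<;
         combine-injective; remQuot-combine; combine-remQuot; splitAt-join; join-splitAt;
         injective⇒≤; +↔⊎; *↔×; 1↔⊤)
  renaming (<-cmp to <-cmpᶠ)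
open import Data.Fin.Induction using (<-wellFounded)
open import Data.Fin.Subset using (Subset; ⁅_⁆; _∪_; ∣_∣) renaming (_∈_ to _∈ₛ_; ⊥ to ∅)
open import Data.Fin.Subset.Properties
  using (x∈p∪q⁺; x∈p∪q⁻; x∈⁅x⁆; x∈⁅y⁆⇒x≡y; ∉⊥; ∣⊥∣≡0; ∣⁅x⁆∣≡1)
open import Data.Bool using (Bool; true; false; T; not; _∧_)
open import Data.Bool.Properties using (T-≡; T-∧)
open import Data.List using (List; []; _∷_; map; length; foldr; allFin)
open import Data.List.Properties using (length-map; length-tabulate)
open import Data.List.Membership.Propositional using (_∈_)
open import Data.List.Membership.Propositional.Properties using (∈-map⁺; ∈-map⁻; ∈-allFin)
open import Data.List.Relation.Unary.Any using (here; there)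
open import Data.Vec using (_∷_; [])
open import Data.Product using (_,_; proj₁; proj₂; uncurry)
open import Data.Product.Function.NonDependent.Propositional using (_×-↔_)
open import Data.Sum using (_⊎_; inj₁; inj₂; [_,_]; map₂)
open import Data.Sum.Function.Propositional using (_⊎-↔_)
open import Data.Sum.Properties using (inj₂-injective)
open import Data.Unit using (⊤; tt)
open import Data.Empty using (⊥; ⊥-elim)
open import Function using (_∘_; id; const; _↔_; Inverse; Injection; Equivalence; mk⇔)
open import Function.Definitions using (Injective)
open import Function.Properties.Inverse using (↔-refl; ↔-sym; ↔-trans; ↔⇒↣)
open import Induction.WellFounded using (Acc; acc)
open import Relation.Nullary using (¬_; yes; no)
open import Relation.Nullary.Decidable
  using (⌊_⌋; toWitness; fromWitness; fromWitnessFalse; isYes≗does; does-⇔)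
open import Relation.Binary.Definitions using (tri<; tri≈; tri>)
open import Relation.Binary.PropositionalEquality hiding ([_])

triangle : ℕ → ℕ
triangle zero    = 1
triangle (suc k) = suc k + suc (triangle k)

triangle*2 : ∀ k → triangle k * 2 ≡ suc k * suc (suc k)
triangle*2 zero    = refl
triangle*2 (suc k) = begin
  (suc k + suc (triangle k)) * 2        ≡⟨ expand k (triangle k) ⟩
  2 * suc (suc k) + triangle k * 2      ≡⟨ cong (2 * suc (suc k) +_) (triangle*2 k) ⟩
  2 * suc (suc k) + suc k * suc (suc k) ≡⟨ collect k ⟩
  suc (suc k) * suc (suc (suc k))       ∎
  where
  open ≡-Reasoning
  open +-*-Solver
  expand : ∀ k t → (suc k + suc t) * 2 ≡ 2 * suc (suc k) + t * 2
  expand = solve 2 (λ k t → (con 1 :+ k :+ (con 1 :+ t)) :* con 2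
                          := con 2 :* (con 2 :+ k) :+ t :* con 2) refl
  collect : ∀ k → 2 * suc (suc k) + suc k * suc (suc k) ≡ suc (suc k) * suc (suc (suc k))
  collect = solve 1 (λ k → con 2 :* (con 2 :+ k) :+ (con 1 :+ k) :* (con 2 :+ k)
                        := (con 2 :+ k) :* (con 3 :+ k)) refl

triangle≡ : ∀ k → triangle k ≡ (suc k * suc (suc k)) / 2
triangle≡ k = trans (sym (m*n/n≡m (triangle k) 2)) (cong (_/ 2) (triangle*2 k))

record Triple {K t : ℕ} (f : Fin K → Fin t) : Set where
  field
    x y z : Fin K
    x≢y   : x ≢ y
    x≢z   : x ≢ z
    y≢z   : y ≢ z
    fx≡fy : f x ≡ f y
    fx≡fz : f x ≡ f z

Triple-map : ∀ {K L t u} {f : Fin K → Fin t} {g : Fin L → Fin u} (e : Fin L → Fin K) →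
             Injective _≡_ _≡_ e → (∀ {a b} → g a ≡ g b → f (e a) ≡ f (e b)) →
             Triple g → Triple f
Triple-map e e-inj e-col T = record
  { x = e x ; y = e y ; z = e z
  ; x≢y = x≢y ∘ e-inj ; x≢z = x≢z ∘ e-inj ; y≢z = y≢z ∘ e-inj
  ; fx≡fy = e-col fx≡fy ; fx≡fz = e-col fx≡fz
  }
  where open Triple T

module _ {K : ℕ} {i j : Fin (suc (suc K))} (i≢j : i ≢ j) where
  skip₂ : Fin K → Fin (suc (suc K))
  skip₂ = punchIn i ∘ punchIn (punchOut i≢j)

  skip₂-injective : Injective _≡_ _≡_ skip₂
  skip₂-injective = punchIn-injective (punchOut i≢j) _ _ ∘ punchIn-injective i _ _

  skip₂≢ˡ : ∀ a → skip₂ a ≢ i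
  skip₂≢ˡ _ = punchInᵢ≢i i _

  skip₂≢ʳ : ∀ a → skip₂ a ≢ j
  skip₂≢ʳ a eq = punchInᵢ≢i (punchOut i≢j) a
    (punchIn-injective i _ _ (trans eq (sym (punchIn-punchOut i≢j))))

pigeonhole₃ : ∀ {K t} → 2 * t < K → (f : Fin K → Fin t) → Triple f
pigeonhole₃ {suc K} {zero} _ f with f fzero
... | ()
pigeonhole₃ {suc (suc K)} {suc t} (s≤s (s≤s 2t+1≤K)) f
  with i , j , i<j , fi≡fj ← pigeonhole (s≤s (s≤s (≤-trans (m≤m+n t _) 2t+1≤K))) f
  with i≢j ← <⇒≢ i<j
  with any? (λ a → f (skip₂ i≢j a) ≟ f i)
... | yes (a , fa≡fi) = record
  { x = i ; y = j ; z = skip₂ i≢j a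
  ; x≢y = i≢j ; x≢z = skip₂≢ˡ i≢j a ∘ sym ; y≢z = skip₂≢ʳ i≢j a ∘ sym
  ; fx≡fy = fi≡fj ; fx≡fz = sym fa≡fi
  }
... | no ¬fa≡fi = Triple-map (skip₂ i≢j) (skip₂-injective i≢j)
                    (punchOut-injective {i = f i} _ _) (pigeonhole₃ 2t<K g)
  where
  g : Fin K → Fin t
  g a = punchOut {i = f i} {j = f (skip₂ i≢j a)} (λ eq → ¬fa≡fi (a , sym eq))

  2t<K : 2 * t < K
  2t<K = subst (_≤ K) (+-suc t (t + 0)) 2t+1≤K

module _ {A B : Set} (f : A → B) (p : A → ℕ) where
  record Sandwich : Set where
    field
      lo md hi : A
      f-lo     : f lo ≡ f md
      f-hi     : f hi ≡ f md
      lo<md    : p lo < p md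
      md<hi    : p md < p hi

  private
    sandwiched : ∀ {κ lo md hi} → f lo ≡ κ → f md ≡ κ → f hi ≡ κ →
                 p lo < p md → p md < p hi → Sandwich
    sandwiched f-lo f-md f-hi lo<md md<hi = record
      { f-lo = trans f-lo (sym f-md) ; f-hi = trans f-hi (sym f-md)
      ; lo<md = lo<md ; md<hi = md<hi
      }

    insert : ∀ {κ lo hi c} → f lo ≡ κ → f hi ≡ κ → f c ≡ κ →
             p lo < p hi → p c ≢ p lo → p c ≢ p hi → Sandwich
    insert {c = c} f-lo f-hi f-c lo<hi c≢lo c≢hi with <-cmp (p c) _
    ... | tri< c<lo _ _ = sandwiched f-c f-lo f-hi c<lo lo<hi
    ... | tri≈ _ c≡lo _ = ⊥-elim (c≢lo c≡lo)
    ... | tri> _ _ lo<c with <-cmp (p c) _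
    ...   | tri< c<hi _ _ = sandwiched f-lo f-c f-hi lo<c c<hi
    ...   | tri≈ _ c≡hi _ = ⊥-elim (c≢hi c≡hi)
    ...   | tri> _ _ hi<c = sandwiched f-lo f-hi f-c lo<hi hi<c

  sort₃ : ∀ {κ a b c} → f a ≡ κ → f b ≡ κ → f c ≡ κ →
          p a ≢ p b → p a ≢ p c → p b ≢ p c → Sandwich
  sort₃ {a = a} {b} f-a f-b f-c a≢b a≢c b≢c with <-cmp (p a) (p b)
  ... | tri< a<b _ _ = insert f-a f-b f-c a<b (a≢c ∘ sym) (b≢c ∘ sym)
  ... | tri≈ _ a≡b _ = ⊥-elim (a≢b a≡b)
  ... | tri> _ _ b<a = insert f-b f-a f-c b<a (b≢c ∘ sym) (a≢c ∘ sym)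

sandwich : ∀ {K t} → 2 * t < K → (f : Fin K → Fin t) (p : Fin K → ℕ) →
           (∀ {a b} → f a ≡ f b → p a ≡ p b → a ≡ b) → Sandwich f p
sandwich 2t<K f p inj = sort₃ f p refl (sym fx≡fy) (sym fx≡fz)
  (x≢y ∘ inj fx≡fy) (x≢z ∘ inj fx≡fz) (y≢z ∘ inj (trans (sym fx≡fy) fx≡fz))
  where open Triple (pigeonhole₃ 2t<K f)

injective-⊎ : ∀ {A B C : Set} (h : A ⊎ B → C) →
              Injective _≡_ _≡_ (h ∘ inj₁) → Injective _≡_ _≡_ (h ∘ inj₂) →
              (∀ a b → h (inj₁ a) ≢ h (inj₂ b)) → Injective _≡_ _≡_ h
injective-⊎ _ inj-a _     _        {inj₁ a} {inj₁ a′} eq = cong inj₁ (inj-a eq)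
injective-⊎ _ _     _     disjoint {inj₁ a} {inj₂ b}  eq = ⊥-elim (disjoint a b eq)
injective-⊎ _ _     _     disjoint {inj₂ b} {inj₁ a}  eq = ⊥-elim (disjoint a b (sym eq))
injective-⊎ _ _     inj-b _        {inj₂ b} {inj₂ b′} eq = cong inj₂ (inj-b eq)

injective-splitAt : ∀ m {n} {C : Set} (h : Fin m ⊎ Fin n → C) →
                    Injective _≡_ _≡_ h → Injective _≡_ _≡_ (h ∘ splitAt m)
injective-splitAt m {n} _ h-inj {i} {j} eq =
  trans (sym (join-splitAt m n i)) (trans (cong (join m n) (h-inj eq)) (join-splitAt m n j))

join-injective : ∀ {m n} (p q : Fin m ⊎ Fin n) → join m n p ≡ join m n q → p ≡ q
join-injective {m} {n} p q eq =
  trans (sym (splitAt-join m n p)) (trans (cong (splitAt m) eq) (splitAt-join m n q))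

combine-<-lex : ∀ {M B} (c d : Fin M) (p q : Fin B) →
                toℕ (combine c p) < toℕ (combine d q) → toℕ c < toℕ d ⊎ (c ≡ d × toℕ p < toℕ q)
combine-<-lex {B = B} c d p q lt with <-cmpᶠ c d
... | tri< c<d _ _  = inj₁ c<d
... | tri≈ _ refl _ = inj₂ (refl , +-cancelˡ-< (B * toℕ c) _ _
                                     (subst₂ _<_ (toℕ-combine c p) (toℕ-combine c q) lt))
... | tri> _ _ d<c  = ⊥-elim (<-asym lt (combine-monoˡ-< q p d<c))

⌊≟⌋-sym : ∀ {n} (c d : Fin n) → ⌊ c ≟ d ⌋ ≡ ⌊ d ≟ c ⌋
⌊≟⌋-sym c d = begin
  ⌊ c ≟ d ⌋ ≡⟨ isYes≗does (c ≟ d) ⟩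
  _         ≡⟨ does-⇔ (mk⇔ sym sym) (c ≟ d) (d ≟ c) ⟩
  _         ≡⟨ isYes≗does (d ≟ c) ⟨
  ⌊ d ≟ c ⌋ ∎
  where open ≡-Reasoning

⌊≟⌋-refl : ∀ {n} (c : Fin n) → ⌊ c ≟ c ⌋ ≡ true
⌊≟⌋-refl c = cong ⌊_⌋ (≡-≟-identity _≟_ refl)

T-irreflexive : ∀ {A : Set} (R : A → A → Bool) → (∀ a → R a a ≡ false) → ∀ a → ¬ T (R a a)
T-irreflexive R R-irr a = subst T (R-irr a)

module _ {A : Set} (R : A → A → Bool) where
  cone : Fin 1 ⊎ A → Fin 1 ⊎ A → Bool
  cone (inj₁ _) (inj₁ _) = false
  cone (inj₁ _) (inj₂ _) = true
  cone (inj₂ _) (inj₁ _) = true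
  cone (inj₂ a) (inj₂ b) = R a b

  copies : (M : ℕ) → Fin M × A → Fin M × A → Bool
  copies M (c , a) (d , b) = ⌊ c ≟ d ⌋ ∧ R a b

  module _ (R-sym : ∀ a b → R a b ≡ R b a) where
    cone-sym : ∀ x y → cone x y ≡ cone y x
    cone-sym (inj₁ _) (inj₁ _) = refl
    cone-sym (inj₁ _) (inj₂ _) = refl
    cone-sym (inj₂ _) (inj₁ _) = refl
    cone-sym (inj₂ a) (inj₂ b) = R-sym a b

    copies-sym : ∀ M x y → copies M x y ≡ copies M y x
    copies-sym M (c , a) (d , b) = cong₂ _∧_ (⌊≟⌋-sym c d) (R-sym a b)

  module _ (R-irr : ∀ a → R a a ≡ false) where
    cone-irr : ∀ x → cone x x ≡ false
    cone-irr (inj₁ fzero) = refl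
    cone-irr (inj₂ a)     = R-irr a

    copies-irr : ∀ M x → copies M x x ≡ false
    copies-irr M (c , a) rewrite ⌊≟⌋-refl c = R-irr a

  T-copies : ∀ {M} (x y : Fin M × A) → T (copies M x y) →
             proj₁ x ≡ proj₁ y × T (R (proj₂ x) (proj₂ y))
  T-copies (c , a) (d , b) cd = let c≟d , ab = Equivalence.to T-∧ cd in toWitness c≟d , ab

  T-copies⁺ : ∀ {M} {c : Fin M} {a b} → T (R a b) → T (copies M (c , a) (c , b))
  T-copies⁺ ab = Equivalence.from T-∧ (fromWitness refl , ab)

-- Unlike XCrossing, noX does not require track v ≢ track w: it follows from proper.
record Layout {V : Set} (E : V → V → Set) (t : ℕ) : Set where
  field
    track  : V → Fin t
    pos    : V → ℕ
    proper : ∀ {u v} → E u v → track u ≢ track v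
    posInj : ∀ {u v} → track u ≡ track v → pos u ≡ pos v → u ≡ v
    noX    : ∀ {v w x y} → E v w → E x y → track v ≡ track x → track w ≡ track y →
             pos v < pos x → pos y < pos w → ⊥

pullback : ∀ {V W : Set} {E : V → V → Set} {F : W → W → Set} {t} (e : W → V) →
           Injective _≡_ _≡_ e → (∀ {a b} → F a b → E (e a) (e b)) →
           Layout E t → Layout F t
pullback e e-inj e-edge L = record
  { track  = track ∘ e
  ; pos    = pos ∘ e
  ; proper = proper ∘ e-edge
  ; posInj = λ same-track same-pos → e-inj (posInj same-track same-pos)
  ; noX    = λ vw xy → noX (e-edge vw) (e-edge xy)
  }
  where open Layout L

module _ {G : Graph} {t : ℕ} where
  fromTrackLayout : TrackLayout G t → Layout (Edge G) t
  fromTrackLayout L = record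
    { track  = track
    ; pos    = pos
    ; proper = proper _ _
    ; posInj = posInj _ _
    ; noX    = λ vw xy tv≡tx tw≡ty v<x y<w →
                 noX (_ , _ , _ , _ , vw , xy , tv≡tx , tw≡ty , proper _ _ vw , v<x , y<w)
    }
    where
    open TrackLayout L
    open TrackAssignment assignment

  toTrackLayout : Layout (Edge G) t → TrackLayout G t
  toTrackLayout L = record
    { assignment = record
      { track  = track
      ; pos    = pos
      ; proper = λ _ _ → proper
      ; posInj = λ _ _ → posInj
      }
    ; noX = λ (_ , _ , _ , _ , vw , xy , tv≡tx , tw≡ty , _ , v<x , y<w) →
              noX vw xy tv≡tx tw≡ty v<x y<w
    }
    where open Layout L

record BoundedLayout {V : Set} (E : V → V → Set) (t : ℕ) : Set where
  field
    layout    : Layout E t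
    bound     : ℕ
    pos<bound : ∀ v → Layout.pos layout v < bound
  open Layout layout public

module _ {V : Set} {E : V → V → Set} {s : ℕ} {E⁺ : Fin s ⊎ V → Fin s ⊎ V → Set}
         (E⁺-irrefl : ∀ x → ¬ E⁺ x x)
         (E⁺-restrict : ∀ {a b} → E⁺ (inj₂ a) (inj₂ b) → E a b)
         {t : ℕ} (L : BoundedLayout E t) where
  open BoundedLayout L

  private
    track⁺ : Fin s ⊎ V → Fin (s + t)
    track⁺ = join s t ∘ map₂ track

    pos⁺ : Fin s ⊎ V → ℕ
    pos⁺ = [ const 0 , pos ]

  data SameTrack : Fin s ⊎ V → Fin s ⊎ V → Set where
    alone  : ∀ i → SameTrack (inj₁ i) (inj₁ i)
    shared : ∀ {a b} → track a ≡ track b → SameTrack (inj₂ a) (inj₂ b)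

  sameTrack : ∀ x y → track⁺ x ≡ track⁺ y → SameTrack x y
  sameTrack x y eq = fromTracks x y (join-injective (map₂ track x) (map₂ track y) eq)
    where
    fromTracks : ∀ x y → map₂ track x ≡ map₂ track y → SameTrack x y
    fromTracks (inj₁ i) (inj₁ .i) refl = alone i
    fromTracks (inj₂ a) (inj₂ b)  eq   = shared (inj₂-injective eq)

  addPrivateTracks : BoundedLayout E⁺ (s + t)
  addPrivateTracks = record
    { layout    = record
      { track  = track⁺
      ; pos    = pos⁺
      ; proper = λ {x} {y} xy eq → proper-sameTrack xy (sameTrack x y eq)
      ; posInj = λ {x} {y} eq → posInj-sameTrack (sameTrack x y eq)
      ; noX    = λ {v} {w} {x} {y} vw xy tv≡tx tw≡ty →
                   noX-sameTrack vw xy (sameTrack v x tv≡tx) (sameTrack w y tw≡ty)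
      }
    ; bound     = suc bound
    ; pos<bound = [ (λ _ → s≤s z≤n) , m<n⇒m<1+n ∘ pos<bound ]
    }
    where
    proper-sameTrack : ∀ {x y} → E⁺ x y → SameTrack x y → ⊥
    proper-sameTrack xy (alone _)   = E⁺-irrefl _ xy
    proper-sameTrack xy (shared eq) = proper (E⁺-restrict xy) eq

    posInj-sameTrack : ∀ {x y} → SameTrack x y → pos⁺ x ≡ pos⁺ y → x ≡ y
    posInj-sameTrack (alone _)   _  = refl
    posInj-sameTrack (shared eq) p≡ = cong inj₂ (posInj eq p≡)

    noX-sameTrack : ∀ {v w x y} → E⁺ v w → E⁺ x y → SameTrack v x → SameTrack w y →
                    pos⁺ v < pos⁺ x → pos⁺ y < pos⁺ w → ⊥
    noX-sameTrack _  _  (alone _)      _              v<x _   = <-irrefl refl v<x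
    noX-sameTrack _  _  (shared _)     (alone _)      _   y<w = <-irrefl refl y<w
    noX-sameTrack vw xy (shared tv≡tx) (shared tw≡ty) v<x y<w =
      noX (E⁺-restrict vw) (E⁺-restrict xy) tv≡tx tw≡ty v<x y<w

-- Copy c occupies the positions c * bound, ..., c * bound + bound - 1 of every track.
module _ {V : Set} {R : V → V → Bool} (M : ℕ) {t : ℕ}
         (L : BoundedLayout (λ a b → T (R a b)) t) where
  open BoundedLayout L

  private
    slot : V → Fin bound
    slot v = fromℕ< (pos<bound v)

    toℕ-slot : ∀ v → toℕ (slot v) ≡ pos v
    toℕ-slot v = toℕ-fromℕ< (pos<bound v)

    E× : Fin M × V → Fin M × V → Set
    E× x y = T (copies R M x y)

    track× : Fin M × V → Fin t
    track× (c , a) = track a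

    pos× : Fin M × V → ℕ
    pos× (c , a) = toℕ (combine c (slot a))

  blockwise : BoundedLayout (λ x y → T (copies R M x y)) t
  blockwise = record
    { layout    = record
      { track  = track×
      ; pos    = pos×
      ; proper = λ {x} {y} → proper ∘ proj₂ ∘ T-copies R x y
      ; posInj = posInj×
      ; noX    = noX×
      }
    ; bound     = M * bound
    ; pos<bound = λ (c , a) → toℕ<n (combine c (slot a))
    }
    where
    posInj× : ∀ {x y} → track× x ≡ track× y → pos× x ≡ pos× y → x ≡ y
    posInj× {c , a} {d , b} ta≡tb eq
      with refl , slot≡ ← combine-injective c (slot a) d (slot b) (toℕ-injective eq)
      = cong (c ,_) (posInj ta≡tb (subst₂ _≡_ (toℕ-slot a) (toℕ-slot b) (cong toℕ slot≡)))

    noX× : ∀ {v w x y} → E× v w → E× x y → track× v ≡ track× x → track× w ≡ track× y →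
           pos× v < pos× x → pos× y < pos× w → ⊥
    noX× {c , a} {_ , a′} {d , b} {_ , b′} vw xy ta≡tb ta′≡tb′ v<x y<w
      with refl , aa′ ← T-copies R _ _ vw | refl , bb′ ← T-copies R _ _ xy
      with combine-<-lex c d (slot a) (slot b) v<x | combine-<-lex d c (slot b′) (slot a′) y<w
    ... | inj₁ c<d        | inj₁ d<c         = <-asym c<d d<c
    ... | inj₁ c<d        | inj₂ (refl , _)  = <-irrefl refl c<d
    ... | inj₂ (refl , _) | inj₁ d<c         = <-irrefl refl d<c
    ... | inj₂ (_ , a<b)  | inj₂ (_ , b′<a′) =
      noX aa′ bb′ ta≡tb ta′≡tb′ (subst₂ _<_ (toℕ-slot a) (toℕ-slot b) a<b)
                                (subst₂ _<_ (toℕ-slot b′) (toℕ-slot a′) b′<a′)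

module _ {A : Set} {R : A → A → Set} {P : A → Set} where
  walk-++ : ∀ {a b c} → WalkIn R P a b → WalkIn R P b c → WalkIn R P a c
  walk-++ (stay _)      q = q
  walk-++ (step pa r p) q = step pa r (walk-++ p q)

  walk-start : ∀ {a b} → WalkIn R P a b → P a
  walk-start (stay pa)     = pa
  walk-start (step pa _ _) = pa

  module _ (R-sym : ∀ {a b} → R a b → R b a) where
    walk-reverse : ∀ {a b} → WalkIn R P a b → WalkIn R P b a
    walk-reverse (stay pa)     = stay pa
    walk-reverse (step pa r p) = walk-++ (walk-reverse p) (step (walk-start p) (R-sym r) (stay pa))

    connected-via : ∀ hub → (∀ {a} → P a → WalkIn R P a hub) →
                    ∀ {a b} → P a → P b → WalkIn R P a b
    connected-via hub to-hub pa pb = walk-++ (to-hub pa) (walk-reverse (to-hub pb))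

walk-map : ∀ {A B : Set} {R : A → A → Set} {P : A → Set} {S : B → B → Set} {Q : B → Set}
           (f : A → B) → (∀ {a b} → R a b → S (f a) (f b)) → (∀ {a} → P a → Q (f a)) →
           ∀ {a b} → WalkIn R P a b → WalkIn S Q (f a) (f b)
walk-map f f-R f-P (stay pa)     = stay (f-P pa)
walk-map f f-R f-P (step pa r p) = step (f-P pa) (f-R r) (walk-map f f-R f-P p)

TreeAdj-sym : ∀ T {a b} → TreeAdj T a b → TreeAdj T b a
TreeAdj-sym T (inj₁ e) = inj₂ e
TreeAdj-sym T (inj₂ e) = inj₁ e

walk-to-root : ∀ T (x : Node T) → WalkIn (TreeAdj T) (const ⊤) x fzero
walk-to-root T x = go x (<-wellFounded x)
  where
  go : ∀ x → Acc _ x → WalkIn (TreeAdj T) (const ⊤) x fzero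
  go fzero    _        = stay tt
  go (fsuc i) (acc rs) =
    step tt (inj₁ (i , refl , refl)) (go (parent T i) (rs (s≤s (parent< T i))))

-- hang is M disjoint copies of T with their roots joined to a new root; node x of copy c
-- is numbered 1 + combine c x.
module Hang (M : ℕ) (T : Tree) where
  private
    S = suc (m T)

    parentOf : Fin M × Node T → Fin (suc (M * S))
    parentOf (c , fzero)  = fzero
    parentOf (c , fsuc y) = fsuc (combine c (parent T y))

    parentOf≤ : ∀ c x → toℕ (parentOf (c , x)) ≤ toℕ (combine c x)
    parentOf≤ c fzero    = z≤n
    parentOf≤ c (fsuc y) = begin
      suc (toℕ (combine c (parent T y))) ≡⟨ cong suc (toℕ-combine c (parent T y)) ⟩
      suc (S * toℕ c + toℕ (parent T y)) ≤⟨ s≤s (+-monoʳ-≤ (S * toℕ c) (parent< T y)) ⟩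
      suc (S * toℕ c + toℕ y)            ≡⟨ +-suc (S * toℕ c) (toℕ y) ⟨
      S * toℕ c + toℕ (fsuc y)           ≡⟨ toℕ-combine c (fsuc y) ⟨
      toℕ (combine c (fsuc y))           ∎
      where open ≤-Reasoning

  hang : Tree
  hang = record
    { m       = M * S
    ; parent  = parentOf ∘ remQuot {M} S
    ; parent< = λ i → subst (λ j → toℕ (parentOf (remQuot {M} S i)) ≤ toℕ j)
                        (combine-remQuot {M} S i) (uncurry parentOf≤ (remQuot {M} S i))
    }

  below : Fin M → Node T → Node hang
  below c x = fsuc (combine c x)

  private
    parent-below : ∀ c x → parent hang (combine c x) ≡ parentOf (c , x)
    parent-below c x = cong parentOf (remQuot-combine c x)

  below-root-adj : ∀ c → TreeAdj hang (below c fzero) fzero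
  below-root-adj c = inj₁ (combine c fzero , refl , sym (parent-below c fzero))

  below-adj : ∀ c {x y} → TreeAdj T x y → TreeAdj hang (below c x) (below c y)
  below-adj c (inj₁ (i , refl , refl)) =
    inj₁ (combine c (fsuc i) , refl , sym (parent-below c (fsuc i)))
  below-adj c (inj₂ (i , refl , refl)) =
    inj₂ (combine c (fsuc i) , refl , sym (parent-below c (fsuc i)))

  data View : Node hang → Set where
    root : View fzero
    sub  : ∀ c x → View (below c x)

  view : ∀ z → View z
  view fzero    = root
  view (fsuc i) = subst (View ∘ fsuc) (combine-remQuot {M} S i) (uncurry sub (remQuot {M} S i))

  module _ {A : Set} (r : A) (f : Fin M → Node T → A) where
    hangRec : Node hang → A
    hangRec fzero    = r
    hangRec (fsuc i) = uncurry f (remQuot {M} S i)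

    hangRec-below : ∀ c x → hangRec (below c x) ≡ f c x
    hangRec-below c x = cong (uncurry f) (remQuot-combine c x)

∣p∪q∣≤∣p∣+∣q∣ : ∀ {n} (p q : Subset n) → ∣ p ∪ q ∣ ≤ ∣ p ∣ + ∣ q ∣
∣p∪q∣≤∣p∣+∣q∣ []          []          = z≤n
∣p∪q∣≤∣p∣+∣q∣ (true ∷ p)  (true ∷ q)  =
  s≤s (≤-trans (∣p∪q∣≤∣p∣+∣q∣ p q) (+-monoʳ-≤ ∣ p ∣ (n≤1+n _)))
∣p∪q∣≤∣p∣+∣q∣ (true ∷ p)  (false ∷ q) = s≤s (∣p∪q∣≤∣p∣+∣q∣ p q)
∣p∪q∣≤∣p∣+∣q∣ (false ∷ p) (true ∷ q)  =
  subst (suc ∣ p ∪ q ∣ ≤_) (sym (+-suc ∣ p ∣ ∣ q ∣)) (s≤s (∣p∪q∣≤∣p∣+∣q∣ p q))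
∣p∪q∣≤∣p∣+∣q∣ (false ∷ p) (false ∷ q) = ∣p∪q∣≤∣p∣+∣q∣ p q

fromList : ∀ {n} → List (Fin n) → Subset n
fromList = foldr (λ a s → ⁅ a ⁆ ∪ s) ∅

∣fromList∣≤length : ∀ {n} (as : List (Fin n)) → ∣ fromList as ∣ ≤ length as
∣fromList∣≤length {n} []       = ≤-reflexive (∣⊥∣≡0 n)
∣fromList∣≤length     (a ∷ as) = begin
  ∣ ⁅ a ⁆ ∪ fromList as ∣          ≤⟨ ∣p∪q∣≤∣p∣+∣q∣ ⁅ a ⁆ (fromList as) ⟩
  ∣ ⁅ a ⁆ ∣ + ∣ fromList as ∣      ≡⟨ cong (_+ ∣ fromList as ∣) (∣⁅x⁆∣≡1 a) ⟩
  suc ∣ fromList as ∣              ≤⟨ s≤s (∣fromList∣≤length as) ⟩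
  suc (length as)                  ∎
  where open ≤-Reasoning

∈-fromList⁺ : ∀ {n} {a : Fin n} {as} → a ∈ as → a ∈ₛ fromList as
∈-fromList⁺ {as = b ∷ _}  (here refl) = x∈p∪q⁺ (inj₁ (x∈⁅x⁆ b))
∈-fromList⁺ {as = b ∷ as} (there a∈)  = x∈p∪q⁺ {p = ⁅ b ⁆} (inj₂ (∈-fromList⁺ a∈))

∈-fromList⁻ : ∀ {n} {a : Fin n} as → a ∈ₛ fromList as → a ∈ as
∈-fromList⁻ []       a∈ = ⊥-elim (∉⊥ a∈)
∈-fromList⁻ (b ∷ as) a∈ with x∈p∪q⁻ ⁅ b ⁆ (fromList as) a∈
... | inj₁ a∈b  = here (x∈⁅y⁆⇒x≡y b a∈b)
... | inj₂ a∈as = there (∈-fromList⁻ as a∈as)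

record ListDecomposition {V : Set} (E : V → V → Set) (k : ℕ) : Set where
  field
    tree      : Tree
    bag       : Node tree → List V
    vertexCov : ∀ v → Σ (Node tree) λ x → v ∈ bag x
    edgeCov   : ∀ {u v} → E u v → Σ (Node tree) λ x → u ∈ bag x × v ∈ bag x
    connected : ∀ v {x y} → v ∈ bag x → v ∈ bag y →
                WalkIn (TreeAdj tree) (λ z → v ∈ bag z) x y
    width     : ∀ x → length (bag x) ≤ suc k

module FinGraph {V : Set} {n : ℕ} (index : V ↔ Fin n) (adj : V → V → Bool)
                (adj-sym : ∀ u v → adj u v ≡ adj v u) (adj-irr : ∀ v → adj v v ≡ false) where
  open Inverse index using (to; from; strictlyInverseˡ; strictlyInverseʳ)

  graph : Graph
  graph = record
    { n   = n
    ; adj = λ a b → adj (from a) (from b)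
    ; sym = λ a b → adj-sym (from a) (from b)
    ; irr = λ a → adj-irr (from a)
    }

  Adj : V → V → Set
  Adj u v = T (adj u v)

  private
    Edge⇒Adj : ∀ {a b} → Edge graph a b → Adj (from a) (from b)
    Edge⇒Adj = Equivalence.from T-≡

    Adj⇒Edge : ∀ {u v} → Adj u v → Edge graph (to u) (to v)
    Adj⇒Edge {u} {v} uv = subst₂ (λ x y → adj x y ≡ true)
      (sym (strictlyInverseʳ u)) (sym (strictlyInverseʳ v)) (Equivalence.to T-≡ uv)

  encodeLayout : ∀ {t} → Layout Adj t → TrackLayout graph t
  encodeLayout = toTrackLayout ∘ pullback from (Injection.injective (↔⇒↣ (↔-sym index))) Edge⇒Adj

  decodeLayout : ∀ {t} → TrackLayout graph t → Layout Adj t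
  decodeLayout = pullback to (Injection.injective (↔⇒↣ index)) Adj⇒Edge ∘ fromTrackLayout

  encodeDecomposition : ∀ {k} → ListDecomposition Adj k → TreeDecomposition graph k
  encodeDecomposition D = record
    { tree      = tree
    ; bag       = bag′
    ; vertexCov = λ a → let x , a∈ = vertexCov (from a) in x , ∈-bag′⁺ a∈
    ; edgeCov   = λ a b ab → let x , a∈ , b∈ = edgeCov (Edge⇒Adj ab) in
                    x , ∈-bag′⁺ a∈ , ∈-bag′⁺ b∈
    ; connected = λ a x y a∈x a∈y →
                    walk-map id id ∈-bag′⁺ (connected (from a) (∈-bag′⁻ a∈x) (∈-bag′⁻ a∈y))
    ; width     = λ x → ≤-trans (∣fromList∣≤length (map to (bag x)))
                          (subst (_≤ suc _) (sym (length-map to (bag x))) (width x))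
    }
    where
    open ListDecomposition D

    bag′ : Node tree → Subset n
    bag′ x = fromList (map to (bag x))

    ∈-bag′⁺ : ∀ {a x} → from a ∈ bag x → a ∈ₛ bag′ x
    ∈-bag′⁺ {a} {x} a∈ =
      ∈-fromList⁺ {as = map to (bag x)} (subst (_∈ _) (strictlyInverseˡ a) (∈-map⁺ to a∈))

    ∈-bag′⁻ : ∀ {a x} → a ∈ₛ bag′ x → from a ∈ bag x
    ∈-bag′⁻ {a} {x} a∈ with ∈-map⁻ to (∈-fromList⁻ (map to (bag x)) a∈)
    ... | v , v∈ , refl = subst (_∈ bag x) (sym (strictlyInverseʳ v)) v∈

module Construction (M : ℕ) where
  V : ℕ → Set
  V zero    = ⊤
  V (suc j) = Fin (suc j) ⊎ Fin M × (Fin 1 ⊎ V j)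

  pattern clique i = inj₁ i
  pattern apex c   = inj₂ (c , inj₁ fzero)
  pattern copy c a = inj₂ (c , inj₂ a)

  adjacent : ∀ j → V j → V j → Bool
  adjacent zero    _          _           = false
  adjacent (suc j) (inj₂ x)   (inj₂ y)    = copies (cone (adjacent j)) M x y
  adjacent (suc j) (clique i) (clique i′) = not ⌊ i ≟ i′ ⌋
  adjacent (suc j) (clique _) (apex _)    = true
  adjacent (suc j) (apex _)   (clique _)  = true
  adjacent (suc j) (clique _) (copy _ _)  = false
  adjacent (suc j) (copy _ _) (clique _)  = false

  adjacent-sym : ∀ j u v → adjacent j u v ≡ adjacent j v u
  adjacent-sym zero    _          _           = refl
  adjacent-sym (suc j) (inj₂ x)   (inj₂ y)    =
    copies-sym (cone (adjacent j)) (cone-sym (adjacent j) (adjacent-sym j)) M x y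
  adjacent-sym (suc j) (clique i) (clique i′) = cong not (⌊≟⌋-sym i i′)
  adjacent-sym (suc j) (clique _) (apex _)    = refl
  adjacent-sym (suc j) (apex _)   (clique _)  = refl
  adjacent-sym (suc j) (clique _) (copy _ _)  = refl
  adjacent-sym (suc j) (copy _ _) (clique _)  = refl

  adjacent-irr : ∀ j v → adjacent j v v ≡ false
  adjacent-irr zero    _          = refl
  adjacent-irr (suc j) (clique i) = cong not (⌊≟⌋-refl i)
  adjacent-irr (suc j) (inj₂ x)   =
    copies-irr (cone (adjacent j)) (cone-irr (adjacent j) (adjacent-irr j)) M x

  order : ℕ → ℕ
  order zero    = 1
  order (suc j) = suc j + M * suc (order j)

  index : ∀ j → V j ↔ Fin (order j)
  index zero    = ↔-sym 1↔⊤
  index (suc j) = ↔-trans (↔-refl ⊎-↔ copies↔) (↔-sym +↔⊎)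
    where
    cone↔ : (Fin 1 ⊎ V j) ↔ Fin (suc (order j))
    cone↔ = ↔-trans (↔-refl ⊎-↔ index j) (↔-sym +↔⊎)

    copies↔ : (Fin M × (Fin 1 ⊎ V j)) ↔ Fin (M * suc (order j))
    copies↔ = ↔-trans (↔-refl ×-↔ cone↔) (↔-sym *↔×)

  module G (j : ℕ) = FinGraph (index j) (adjacent j) (adjacent-sym j) (adjacent-irr j)

  Adj : ∀ j → V j → V j → Set
  Adj j = G.Adj j

  clique-adj : ∀ {j} {i i′ : Fin (suc j)} → i ≢ i′ → Adj (suc j) (clique i) (clique i′)
  clique-adj = fromWitnessFalse

  clique-apex-adj : ∀ {j} (i : Fin (suc j)) c → Adj (suc j) (clique i) (apex c)
  clique-apex-adj _ _ = tt

  apex-copy-adj : ∀ {j} c (a : V j) → Adj (suc j) (apex c) (copy c a)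
  apex-copy-adj c a = T-copies⁺ (cone (adjacent _)) {c = c} {inj₁ fzero} {inj₂ a} tt

  copy-apex-adj : ∀ {j} c (a : V j) → Adj (suc j) (copy c a) (apex c)
  copy-apex-adj c a = T-copies⁺ (cone (adjacent _)) {c = c} {inj₂ a} {inj₁ fzero} tt

  copy-adj : ∀ {j} c {a b : V j} → Adj j a b → Adj (suc j) (copy c a) (copy c b)
  copy-adj {j} c {a} {b} = T-copies⁺ (cone (adjacent j)) {c = c} {inj₂ a} {inj₂ b}

  tree : ℕ → Tree
  tree zero    = record { m = 0 ; parent = λ () ; parent< = λ () }
  tree (suc j) = Hang.hang M (Hang.hang 1 (tree j))

  private
    module Outer (j : ℕ) = Hang M (Hang.hang 1 (tree j))
    module Inner (j : ℕ) = Hang 1 (tree j)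

  apexNode : ∀ j → Fin M → Node (tree (suc j))
  apexNode j c = Outer.below j c fzero

  copyNode : ∀ j → Fin M → Node (tree j) → Node (tree (suc j))
  copyNode j c y = Outer.below j c (Inner.below j fzero y)

  data NodeView (j : ℕ) : Node (tree (suc j)) → Set where
    at-root : NodeView j fzero
    at-apex : ∀ c → NodeView j (apexNode j c)
    at-copy : ∀ c y → NodeView j (copyNode j c y)

  nodeView : ∀ j z → NodeView j z
  nodeView j z with Outer.view j z
  ... | Outer.root = at-root
  ... | Outer.sub c w with Inner.view j w
  ...   | Inner.root        = at-apex c
  ...   | Inner.sub fzero y = at-copy c y

  apexNode-root-adj : ∀ j c → TreeAdj (tree (suc j)) (apexNode j c) fzero
  apexNode-root-adj j c = Outer.below-root-adj j c

  copyNode-apexNode-adj : ∀ j c → TreeAdj (tree (suc j)) (copyNode j c fzero) (apexNode j c)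
  copyNode-apexNode-adj j c = Outer.below-adj j c (Inner.below-root-adj j fzero)

  copyNode-adj : ∀ j c {x y} → TreeAdj (tree j) x y →
                 TreeAdj (tree (suc j)) (copyNode j c x) (copyNode j c y)
  copyNode-adj j c = Outer.below-adj j c ∘ Inner.below-adj j fzero

  module _ (j : ℕ) {A : Set} (r : A) (a : Fin M → A) (f : Fin M → Node (tree j) → A) where
    private
      belowRec : Fin M → Node (Hang.hang 1 (tree j)) → A
      belowRec c = Inner.hangRec j (a c) λ _ → f c

    nodeRec : Node (tree (suc j)) → A
    nodeRec = Outer.hangRec j r belowRec

    nodeRec-apex : ∀ c → nodeRec (apexNode j c) ≡ a c
    nodeRec-apex c = Outer.hangRec-below j r belowRec c fzero

    nodeRec-copy : ∀ c y → nodeRec (copyNode j c y) ≡ f c y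
    nodeRec-copy c y = trans (Outer.hangRec-below j r belowRec c _)
                              (Inner.hangRec-below j (a c) (λ _ → f c) fzero y)

  cliqueBag : ∀ j → List (V (suc j))
  cliqueBag j = map clique (allFin (suc j))

  apexBag : ∀ j → Fin M → List (V (suc j))
  apexBag j c = apex c ∷ cliqueBag j

  bag : ∀ j → Node (tree j) → List (V j)

  copyBag : ∀ j → Fin M → Node (tree j) → List (V (suc j))
  copyBag j c y = apex c ∷ map (copy c) (bag j y)

  bag zero    _ = tt ∷ []
  bag (suc j)   = nodeRec j (cliqueBag j) (apexBag j) (copyBag j)

  bag-apexNode : ∀ j c → bag (suc j) (apexNode j c) ≡ apexBag j c
  bag-apexNode j = nodeRec-apex j (cliqueBag j) (apexBag j) (copyBag j)

  bag-copyNode : ∀ j c y → bag (suc j) (copyNode j c y) ≡ copyBag j c y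
  bag-copyNode j = nodeRec-copy j (cliqueBag j) (apexBag j) (copyBag j)

  module _ {j : ℕ} where
    ∈-cliqueBag : ∀ i → clique i ∈ cliqueBag j
    ∈-cliqueBag i = ∈-map⁺ clique (∈-allFin i)

    ∈-apexNode⁺ : ∀ {v c} → v ∈ apexBag j c → v ∈ bag (suc j) (apexNode j c)
    ∈-apexNode⁺ = subst (_ ∈_) (sym (bag-apexNode j _))

    ∈-apexNode⁻ : ∀ {v c} → v ∈ bag (suc j) (apexNode j c) → v ∈ apexBag j c
    ∈-apexNode⁻ = subst (_ ∈_) (bag-apexNode j _)

    ∈-copyNode⁺ : ∀ {v c y} → v ∈ copyBag j c y → v ∈ bag (suc j) (copyNode j c y)
    ∈-copyNode⁺ = subst (_ ∈_) (sym (bag-copyNode j _ _))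

    ∈-copyNode⁻ : ∀ {v c y} → v ∈ bag (suc j) (copyNode j c y) → v ∈ copyBag j c y
    ∈-copyNode⁻ = subst (_ ∈_) (bag-copyNode j _ _)

    apex∈copyNode : ∀ c y → apex c ∈ bag (suc j) (copyNode j c y)
    apex∈copyNode c y = ∈-copyNode⁺ (here refl)

    copy∈copyNode : ∀ {c a y} → a ∈ bag j y → copy c a ∈ bag (suc j) (copyNode j c y)
    copy∈copyNode {c} a∈ = ∈-copyNode⁺ (there (∈-map⁺ (copy c) a∈))

    apex∉cliqueBag : ∀ {c} → apex c ∈ cliqueBag j → ⊥
    apex∉cliqueBag p with ∈-map⁻ clique p
    ... | _ , _ , ()

    copy∉cliqueBag : ∀ {c a} → copy c a ∈ cliqueBag j → ⊥
    copy∉cliqueBag p with ∈-map⁻ clique p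
    ... | _ , _ , ()

    clique∉copyBag : ∀ {i c y} → clique i ∈ copyBag j c y → ⊥
    clique∉copyBag (there p) with ∈-map⁻ (copy _) p
    ... | _ , _ , ()

    apex∈apexBag⁻ : ∀ {c d} → apex c ∈ apexBag j d → c ≡ d
    apex∈apexBag⁻ (here refl) = refl
    apex∈apexBag⁻ (there p)   = ⊥-elim (apex∉cliqueBag p)

    apex∈copyBag⁻ : ∀ {c d y} → apex c ∈ copyBag j d y → c ≡ d
    apex∈copyBag⁻ (here refl) = refl
    apex∈copyBag⁻ (there p) with ∈-map⁻ (copy _) p
    ... | _ , _ , ()

    copy∈bag⁻ : ∀ {c a} z → copy c a ∈ bag (suc j) z →
                Σ (Node (tree j)) λ y → z ≡ copyNode j c y × a ∈ bag j y
    copy∈bag⁻ z p with nodeView j z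
    ... | at-root   = ⊥-elim (copy∉cliqueBag p)
    ... | at-apex _ with there q ← ∈-apexNode⁻ p = ⊥-elim (copy∉cliqueBag q)
    ... | at-copy d y with there q ← ∈-copyNode⁻ p with a , a∈ , refl ← ∈-map⁻ (copy d) q =
      y , refl , a∈

  vertex-covered : ∀ j v → Σ (Node (tree j)) λ x → v ∈ bag j x
  vertex-covered zero    tt         = fzero , here refl
  vertex-covered (suc j) (clique i) = fzero , ∈-cliqueBag i
  vertex-covered (suc j) (apex c)   = apexNode j c , ∈-apexNode⁺ (here refl)
  vertex-covered (suc j) (copy c a) =
    let y , a∈ = vertex-covered j a in copyNode j c y , copy∈copyNode a∈

  edge-covered : ∀ j {u v} → Adj j u v → Σ (Node (tree j)) λ x → u ∈ bag j x × v ∈ bag j x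
  edge-covered (suc j) {inj₂ (c , x)} {inj₂ (d , y)} e
    with T-copies (cone (adjacent j)) (c , x) (d , y) e
  edge-covered (suc j) {apex c}   {copy .c b} _ | refl , _ =
    let y , b∈ = vertex-covered j b in copyNode j c y , apex∈copyNode c y , copy∈copyNode b∈
  edge-covered (suc j) {copy c a} {apex .c}   _ | refl , _ =
    let y , a∈ = vertex-covered j a in copyNode j c y , copy∈copyNode a∈ , apex∈copyNode c y
  edge-covered (suc j) {copy c a} {copy .c b} _ | refl , ab =
    let y , a∈ , b∈ = edge-covered j ab in copyNode j c y , copy∈copyNode a∈ , copy∈copyNode b∈
  edge-covered (suc j) {clique i} {clique i′} _ = fzero , ∈-cliqueBag i , ∈-cliqueBag i′
  edge-covered (suc j) {clique i} {apex c}    _ =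
    apexNode j c , ∈-apexNode⁺ (there (∈-cliqueBag i)) , ∈-apexNode⁺ (here refl)
  edge-covered (suc j) {apex c}   {clique i}  _ =
    apexNode j c , ∈-apexNode⁺ (here refl) , ∈-apexNode⁺ (there (∈-cliqueBag i))

  bag-connected : ∀ j v {x y} → v ∈ bag j x → v ∈ bag j y →
                  WalkIn (TreeAdj (tree j)) (λ z → v ∈ bag j z) x y
  bag-connected zero    tt {fzero} {fzero} p _ = stay p
  bag-connected (suc j) (clique i) = connected-via (TreeAdj-sym (tree (suc j))) fzero to-root
    where
    to-root : ∀ {z} → clique i ∈ bag (suc j) z →
              WalkIn (TreeAdj (tree (suc j))) (λ z → clique i ∈ bag (suc j) z) z fzero
    to-root {z} p with nodeView j z
    ... | at-root     = stay p
    ... | at-apex c   = step p (apexNode-root-adj j c) (stay (∈-cliqueBag i))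
    ... | at-copy c y = ⊥-elim (clique∉copyBag (∈-copyNode⁻ p))
  bag-connected (suc j) (apex c) = connected-via (TreeAdj-sym (tree (suc j))) (apexNode j c) to-apex
    where
    to-apex : ∀ {z} → apex c ∈ bag (suc j) z →
              WalkIn (TreeAdj (tree (suc j))) (λ z → apex c ∈ bag (suc j) z) z (apexNode j c)
    to-apex {z} p with nodeView j z
    ... | at-root = ⊥-elim (apex∉cliqueBag p)
    ... | at-apex d with refl ← apex∈apexBag⁻ (∈-apexNode⁻ p) = stay p
    ... | at-copy d y with refl ← apex∈copyBag⁻ (∈-copyNode⁻ p) =
      walk-++ (walk-map (copyNode j c) (copyNode-adj j c) (λ _ → apex∈copyNode c _)
                        (walk-to-root (tree j) y))
              (step (apex∈copyNode c fzero) (copyNode-apexNode-adj j c)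
                    (stay (∈-apexNode⁺ (here refl))))
  bag-connected (suc j) (copy c a) {x} {x′} p p′
    with y , refl , a∈y ← copy∈bag⁻ x p | y′ , refl , a∈y′ ← copy∈bag⁻ x′ p′ =
    walk-map (copyNode j c) (copyNode-adj j c) copy∈copyNode (bag-connected j a a∈y a∈y′)

  length-cliqueBag : ∀ j → length (cliqueBag j) ≡ suc j
  length-cliqueBag j = trans (length-map clique (allFin (suc j))) (length-tabulate id)

  bag-width : ∀ j x → length (bag j x) ≤ suc j
  bag-width zero    _ = s≤s z≤n
  bag-width (suc j) x with nodeView j x
  ... | at-root     = ≤-trans (≤-reflexive (length-cliqueBag j)) (n≤1+n _)
  ... | at-apex c   = subst (λ bs → length bs ≤ suc (suc j)) (sym (bag-apexNode j c))
                        (s≤s (≤-reflexive (length-cliqueBag j)))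
  ... | at-copy c y = subst (λ bs → length bs ≤ suc (suc j)) (sym (bag-copyNode j c y))
                        (s≤s (subst (_≤ suc j) (sym (length-map (copy c) (bag j y)))
                                    (bag-width j y)))

  decomposition : ∀ j → ListDecomposition (Adj j) j
  decomposition j = record
    { tree      = tree j
    ; bag       = bag j
    ; vertexCov = vertex-covered j
    ; edgeCov   = edge-covered j
    ; connected = bag-connected j
    ; width     = bag-width j
    }

  upperLayout : ∀ j → BoundedLayout (Adj j) (triangle j)
  upperLayout zero    = record
    { layout    = record
      { track  = const fzero
      ; pos    = const 0
      ; proper = λ ()
      ; posInj = λ _ _ → refl
      ; noX    = λ ()
      }
    ; bound     = 1
    ; pos<bound = λ _ → s≤s z≤n
    }
  upperLayout (suc j) =
    addPrivateTracks (T-irreflexive (adjacent (suc j)) (adjacent-irr (suc j))) id copiesLayout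
    where
    coneLayout : BoundedLayout (λ x y → T (cone (adjacent j) x y)) (suc (triangle j))
    coneLayout = addPrivateTracks
      (T-irreflexive (cone (adjacent j)) (cone-irr (adjacent j) (adjacent-irr j))) id
      (upperLayout j)

    copiesLayout : BoundedLayout (λ x y → T (copies (cone (adjacent j)) M x y)) (suc (triangle j))
    copiesLayout = blockwise M coneLayout

  module _ {j t : ℕ} (L : Layout (Adj (suc j)) t) where
    open Layout L

    apex-posInj : ∀ {c d} → track (apex c) ≡ track (apex d) → pos (apex c) ≡ pos (apex d) → c ≡ d
    apex-posInj tc≡td pc≡pd with refl ← posInj tc≡td pc≡pd = refl

    copyLayout : Fin M → Layout (Adj j) t
    copyLayout c = pullback (copy c) (λ { refl → refl }) (copy-adj {j} c) L

    module _ (S : Sandwich (track ∘ apex) (pos ∘ apex)) where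
      open Sandwich S

      sandwiched-copy : ∀ i a → track (clique i) ≢ track (copy md a)
      sandwiched-copy i a eq with <-cmp (pos (copy md a)) (pos (clique i))
      ... | tri< copy<clique _ _ =
        noX (copy-apex-adj md a) (clique-apex-adj i lo) (sym eq) (sym f-lo) copy<clique lo<md
      ... | tri≈ _ same-pos _ with () ← posInj (sym eq) same-pos
      ... | tri> _ _ clique<copy =
        noX (clique-apex-adj i hi) (copy-apex-adj md a) eq f-hi clique<copy md<hi

  distinct-tracks : ∀ j {t} → 2 * t < M → (L : Layout (Adj j) t) →
                    Σ (Fin (triangle j) → V j) λ h → Injective _≡_ _≡_ (Layout.track L ∘ h)
  distinct-tracks zero    _    _ = const tt , λ { {fzero} {fzero} _ → refl }
  distinct-tracks (suc j) 2t<M L =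
    [ clique , conePart ] ∘ splitAt (suc j) ,
    injective-splitAt (suc j) _
      (injective-⊎ (track ∘ [ clique , conePart ]) clique-injective cone-injective clique≢cone)
    where
    open Layout L
    S  = sandwich 2t<M (track ∘ apex) (pos ∘ apex) (apex-posInj L)
    md = Sandwich.md S
    IH = distinct-tracks j 2t<M (copyLayout L md)
    h  = proj₁ IH

    conePart : Fin (suc (triangle j)) → V (suc j)
    conePart = [ const (apex md) , copy md ∘ h ] ∘ splitAt 1

    clique-injective : Injective _≡_ _≡_ (track ∘ clique)
    clique-injective {i} {i′} eq with i ≟ i′
    ... | yes i≡i′ = i≡i′
    ... | no  i≢i′ = ⊥-elim (proper (clique-adj i≢i′) eq)

    cone-injective : Injective _≡_ _≡_ (track ∘ conePart)
    cone-injective = injective-splitAt 1 _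
      (injective-⊎ (track ∘ [ const (apex md) , copy md ∘ h ])
        (λ { {fzero} {fzero} _ → refl }) (proj₂ IH) (λ _ b → proper (apex-copy-adj md (h b))))

    clique≢cone : ∀ i z → track (clique i) ≢ track (conePart z)
    clique≢cone i z with splitAt 1 z
    ... | inj₁ _ = proper (clique-apex-adj i md)
    ... | inj₂ b = sandwiched-copy L S i (h b)

  triangle≤tracks : ∀ j {t} → 2 * triangle j < M → Layout (Adj j) t → triangle j ≤ t
  triangle≤tracks j {t} 2T<M L with triangle j ≤? t
  ... | yes T≤t = T≤t
  ... | no  T≰t = injective⇒≤ (proj₂ (distinct-tracks j 2t<M L))
    where
    2t<M : 2 * t < M
    2t<M = ≤-<-trans (*-monoʳ-≤ 2 (<⇒≤ (≰⇒> T≰t))) 2T<M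

theorem7p4 : (k : ℕ) → Σ Graph λ G → TreeWidth≤ G k × TrackNumberIs G ((suc k * suc (suc k)) / 2)
theorem7p4 k = graph , encodeDecomposition (decomposition k) ,
  subst (TrackNumberIs graph) (triangle≡ k)
    (encodeLayout (BoundedLayout.layout (upperLayout k)) ,
     λ t → triangle≤tracks k ≤-refl ∘ decodeLayout)
  where
  M = suc (2 * triangle k)
  open Construction M
  open G k
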